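{- For every finite simple graph $G$ and every positive integer $k$, $\mathrm{mof}_k(G) = T_k(G)$.
   Context: An orientation $D$ of a simple graph $G$ assigns to each edge $\{u,v\}$ exactly one of the arcs $(u,v)$, $(v,u)$; if $(u,v)$ is an arc, $v$ is an out-neighbor of $u$. Oriented $k$-forcing in $D$: given a set of colored vertices, the $k$-color change rule says that any colored vertex having at most $k$ non-colored out-neighbors forces all of these out-neighbors to become colored. Starting from a nonempty set $S\subseteq V(D)$ colored (all others non-colored), the rule is applied repeatedly (all forcings in a step simultaneous) until no further change occurs; $S$ is a $k$-forcing set of $D$ if at the end all vertices are colored. $F_k(D)$ is the minimum size of a $k$-forcing set of $D$. $\mathrm{mof}_k(G)$ is the minimum of $F_k(D)$ over all orientations $D$ of $G$. A $(k+1)$-tree is a tree of maximum degree at most $k+1$; a $(k+1)$-tree cover of $G$ is a set of vertex-disjoint subgraphs of $G$, each a $(k+1)$-tree, covering all vertices of $G$; $T_k(G)$ is the minimum cardinality of a $(k+1)$-tree cover of $G$. -}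

module Defs where

open import Data.Nat using (ℕ; zero; suc; _+_; _≤_; _<_)
open import Data.Bool using (Bool; true; false; _∧_; _∨_; not; if_then_else_)
open import Data.Fin using (Fin; zero; suc; _≟_)
open import Data.Vec using (Vec; lookup; _∷_; [])
open import Data.Product using (Σ; ∃; ∃-syntax; _×_; _,_)
open import Data.Empty using (⊥)
open import Relation.Nullary using (¬_; does)
open import Relation.Binary.PropositionalEquality using (_≡_)
open import Function.Definitions using (Injective)

record Graph (n : ℕ) : Set where
  field
    adj     : Fin n → Fin n → Bool
    symm    : ∀ u v → adj u v ≡ adj v u
    irrefl  : ∀ v → adj v v ≡ false
open Graph public

count : ∀ {n} → (Fin n → Bool) → ℕ
count {zero}  P = 0
count {suc n} P = (if P zero then 1 else 0) + count (λ i → P (suc i))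

-- Orientations: out u v = true  means (u,v) is an arc

record Orientation {n : ℕ} (G : Graph n) : Set where
  field
    out       : Fin n → Fin n → Bool
    covers    : ∀ u v → out u v ∨ out v u ≡ adj G u v
    exclusive : ∀ u v → out u v ∧ out v u ≡ false
open Orientation public

uncoloredOut : ∀ {n} {G : Graph n} → Orientation G → (Fin n → Bool) → Fin n → Fin n → Bool
uncoloredOut D C u v = out D u v ∧ not (C v)

canForce : ∀ {n} {G : Graph n} → ℕ → Orientation G → (Fin n → Bool) → Fin n → Bool
canForce k D C u = C u ∧ does (Data.Nat._≤?_ (count (uncoloredOut D C u)) k)

-- one step of the k-color change rule (all forcings simultaneous):
-- v becomes colored iff it was colored or it is an (uncolored)
-- out-neighbour of some vertex u that can force
anyFin : ∀ {n} → (Fin n → Bool) → Bool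
anyFin {zero}  P = false
anyFin {suc n} P = P zero ∨ anyFin (λ i → P (suc i))

step : ∀ {n} {G : Graph n} → ℕ → Orientation G → (Fin n → Bool) → (Fin n → Bool)
step k D C v = C v ∨ anyFin (λ u → canForce k D C u ∧ uncoloredOut D C u v)

iterate : ∀ {A : Set} → (A → A) → ℕ → A → A
iterate f zero    x = x
iterate f (suc m) x = f (iterate f m x)

IsForcingSet : ∀ {n} {G : Graph n} → ℕ → Orientation G → (Fin n → Bool) → Set
IsForcingSet k D S =
  (∃[ v ] S v ≡ true) × (∃[ m ] (∀ v → iterate (step k D) m S v ≡ true))

IsMinOf : (ℕ → Set) → ℕ → Set
IsMinOf P m = P m × (∀ x → P x → m ≤ x)

IsFk : ∀ {n} {G : Graph n} → ℕ → Orientation G → ℕ → Set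
IsFk k D = IsMinOf (λ s → ∃[ S ] (IsForcingSet k D S × count S ≡ s))

IsMof : ∀ {n} → Graph n → ℕ → ℕ → Set
IsMof G k = IsMinOf (λ m → ∃[ D ] IsFk {G = G} k D m)

data Walk {n : ℕ} (E : Fin n → Fin n → Bool) : Fin n → Fin n → Set where
  here  : ∀ {u} → Walk E u u
  there : ∀ {u w v} → E u w ≡ true → Walk E w v → Walk E u v

HasCycle : ∀ {n} → (Fin n → Fin n → Bool) → Set
HasCycle {n} E =
  ∃[ m ] Σ (Fin (3 + m) → Fin n) λ c →
    Injective _≡_ _≡_ c ×
    (∀ (i : Fin (2 + m)) → E (c (Data.Fin.inject₁ i)) (c (suc i)) ≡ true) ×
    E (c (Data.Fin.fromℕ (2 + m))) (c zero) ≡ true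

IsSubgraph : ∀ {n} → Graph n → (Fin n → Bool) → (Fin n → Fin n → Bool) → Set
IsSubgraph G V E =
  (∀ u v → E u v ≡ true → adj G u v ≡ true) ×
  (∀ u v → E u v ≡ E v u) ×
  (∀ u v → E u v ≡ true → (V u ≡ true × V v ≡ true))

IsTree : ∀ {n} → (Fin n → Bool) → (Fin n → Fin n → Bool) → Set
IsTree V E =
  (∃[ v ] V v ≡ true) ×
  (∀ u v → V u ≡ true → V v ≡ true → Walk E u v) ×
  ¬ HasCycle E

IsKTree : ∀ {n} → ℕ → (Fin n → Bool) → (Fin n → Fin n → Bool) → Set
IsKTree k V E = IsTree V E × (∀ v → V v ≡ true → count (E v) ≤ suc k)

-- a (k+1)-tree cover of G of cardinality c: the vertex sets of the c
-- subgraphs are the classes of `part` (hence disjoint and covering)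
record TreeCover {n : ℕ} (G : Graph n) (k c : ℕ) : Set where
  field
    part   : Fin n → Fin c
    edges  : Fin c → Fin n → Fin n → Bool
  vset : Fin c → Fin n → Bool
  vset i v = does (part v ≟ i)
  field
    subgraph : ∀ i → IsSubgraph G (vset i) (edges i)
    ktree    : ∀ i → IsKTree k (vset i) (edges i)

IsTk : ∀ {n} → Graph n → ℕ → ℕ → Set
IsTk G k = IsMinOf (λ c → TreeCover G k c)

-- Both numbers equal the least number of roots of a spanning forest of G in
-- which every vertex has at most k children.  Given a k-forcing set S of an
-- orientation, let every vertex outside S point to a vertex that forced it:
-- forcing times increase along these pointers, and a vertex forces all of its
-- children in a single step, so it has at most k of them; hence the trees of
-- this forest are (k+1)-trees, one for each vertex of S.  Conversely, root each
-- tree of a (k+1)-tree cover at a leaf (here k ≥ 1 is used), orient tree edges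
-- away from the roots and all other edges towards smaller depth: then the roots
-- force the graph level by level.  Both minima exist since, for each size, the
-- existence of an orientation with a forcing set of that size is decidable by
-- exhaustive search.
module Submission where

open import Data.Bool using (Bool; true; false; _∧_; _∨_; not; if_then_else_)
open import Data.Bool.Properties using (∨-comm; ∧-zeroʳ)
open import Data.Empty using (⊥; ⊥-elim)
open import Data.Fin using (Fin; zero; suc; _≟_; toℕ; fromℕ; inject₁; combine; remQuot)
open import Data.Fin.Properties
  using (any?; all?; injective⇒≤; pigeonhole; <-cmp; suc-injective; remQuot-combine; toℕ-inject₁; toℕ-fromℕ; toℕ<n)
open import Data.Fin.Relation.Unary.Top using (view; ‵fromℕ; ‵inject₁)
open import Data.Fin.Subset.Properties using (anySubset?)
open import Data.Nat using (ℕ; zero; suc; s≤s⁻¹; _+_; _*_; _∸_; _≤_; _<_; z≤n; s≤s; _≤?_)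
open import Data.Nat.Induction using (<-wellFounded)
open import Data.Nat.Properties
  using (≤-refl; ≤-trans; ≤-reflexive; ≤-antisym; ≤-total; <-irrefl; <-asym; <⇒≤; ≤-<-trans; ≮⇒≥; ≰⇒>; n≮0;
         n≤1+n; n<1+n; m≤n⇒m<n∨m≡n; +-comm; +-assoc; +-suc; +-identityʳ; +-mono-≤; +-monoʳ-≤;
         m∸n≤m; m<n⇒0<n∸m; m+[n∸m]≡n; module ≤-Reasoning)
open import Data.Product using (Σ; ∃; ∃₂; ∃-syntax; _×_; _,_; proj₁; proj₂; uncurry)
open import Data.Product.Relation.Binary.Lex.Strict using (×-strictTotalOrder)
open import Data.Sum using (_⊎_; inj₁; inj₂)
open import Data.Vec using (lookup; tabulate)
open import Data.Vec.Properties using (lookup∘tabulate)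
open import Function using (_∘_; case_of_)
open import Induction.WellFounded using (Acc; acc)
open import Relation.Binary using (StrictTotalOrder; tri<; tri≈; tri>)
open import Relation.Binary.PropositionalEquality
  using (_≡_; _≢_; _≗_; refl; sym; trans; cong; cong₂; subst; module ≡-Reasoning)
open import Relation.Nullary using (¬_; ¬?; Dec; yes; no; does; map′; _×-dec_)
open import Relation.Nullary.Decidable using (dec-true; dec-false; decidable-stable)
open import Relation.Unary using (Decidable)
import Data.Bool as Bool
import Data.Fin as Fin
import Data.Fin.Properties as Finₚ
import Data.Nat as ℕ
import Data.Nat.Properties as ℕₚ

open import Defs

private
  variable
    n : ℕ

from-does : ∀ {A : Set} (a? : Dec A) → does a? ≡ true → A
from-does (yes a) _ = a

∨-trueˡ : ∀ {a} b → a ≡ true → a ∨ b ≡ true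
∨-trueˡ b refl = refl

∨-trueʳ : ∀ a {b} → b ≡ true → a ∨ b ≡ true
∨-trueʳ true  _ = refl
∨-trueʳ false p = p

∨-true⁻ : ∀ a {b} → a ∨ b ≡ true → a ≡ true ⊎ b ≡ true
∨-true⁻ true  _ = inj₁ refl
∨-true⁻ false p = inj₂ p

∧-true : ∀ {a b} → a ≡ true → b ≡ true → a ∧ b ≡ true
∧-true refl refl = refl

∧-true⁻ : ∀ a {b} → a ∧ b ≡ true → a ≡ true × b ≡ true
∧-true⁻ true p = refl , p

not-true⁻ : ∀ {a} → not a ≡ true → a ≡ false
not-true⁻ {false} _ = refl

≢true⇒false : ∀ {a} → (a ≡ true → ⊥) → a ≡ false
≢true⇒false {false} _ = refl
≢true⇒false {true}  ¬t = ⊥-elim (¬t refl)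

true≢false : ∀ {a} → a ≡ true → a ≢ false
true≢false refl ()

_⊆_ : (Fin n → Bool) → (Fin n → Bool) → Set
P ⊆ Q = ∀ v → P v ≡ true → Q v ≡ true

count-mono : (P Q : Fin n → Bool) → P ⊆ Q → count P ≤ count Q
count-mono {zero}  P Q P⊆Q = z≤n
count-mono {suc n} P Q P⊆Q with P zero in p | Q zero in q
... | true  | true  = s≤s (count-mono _ _ (P⊆Q ∘ suc))
... | true  | false = ⊥-elim (true≢false (P⊆Q zero p) q)
... | false | true  = ≤-trans (count-mono _ _ (P⊆Q ∘ suc)) (n≤1+n _)
... | false | false = count-mono _ _ (P⊆Q ∘ suc)

count-< : (P Q : Fin n → Bool) → P ⊆ Q → ∀ w → P w ≡ false → Q w ≡ true → count P < count Q
count-< P Q P⊆Q zero p q rewrite p | q = s≤s (count-mono _ _ (P⊆Q ∘ suc))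
count-< P Q P⊆Q (suc w) p q with P zero in p₀ | Q zero in q₀
... | true  | true  = s≤s (count-< _ _ (P⊆Q ∘ suc) w p q)
... | true  | false = ⊥-elim (true≢false (P⊆Q zero p₀) q₀)
... | false | true  = ≤-trans (count-< _ _ (P⊆Q ∘ suc) w p q) (n≤1+n _)
... | false | false = count-< _ _ (P⊆Q ∘ suc) w p q

count-cong : {P Q : Fin n → Bool} → P ≗ Q → count P ≡ count Q
count-cong {zero}  P≗Q = refl
count-cong {suc n} P≗Q = cong₂ _+_ (cong (λ b → if b then 1 else 0) (P≗Q zero)) (count-cong (P≗Q ∘ suc))

count-true : count {n} (λ _ → true) ≡ n
count-true {zero}  = refl
count-true {suc n} = cong suc (count-true {n})

count-full : (P : Fin n → Bool) → n ≤ count P → ∀ v → P v ≡ true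
count-full {n} P n≤count v with P v in p
... | true  = refl
... | false = ⊥-elim (<-irrefl refl (≤-trans (s≤s n≤count)
                (≤-trans (count-< P _ (λ _ _ → refl) v p refl) (≤-reflexive count-true))))

count-∨ : (P Q : Fin n → Bool) → count (λ v → P v ∨ Q v) ≤ count P + count Q
count-∨ {zero}  P Q = z≤n
count-∨ {suc n} P Q with P zero | Q zero
... | true  | true  = s≤s (≤-trans (count-∨ (P ∘ suc) (Q ∘ suc)) (+-monoʳ-≤ (count (P ∘ suc)) (n≤1+n _)))
... | true  | false = s≤s (count-∨ (P ∘ suc) (Q ∘ suc))
... | false | true  = ≤-trans (s≤s (count-∨ (P ∘ suc) (Q ∘ suc))) (≤-reflexive (sym (+-suc _ _)))
... | false | false = count-∨ (P ∘ suc) (Q ∘ suc)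

count-false : count {n} (λ _ → false) ≡ 0
count-false {zero}  = refl
count-false {suc n} = count-false {n}

count-≤-when-nonempty : ∀ {m} (P : Fin n → Bool) → (∀ w → P w ≡ true → count P ≤ m) → count P ≤ m
count-≤-when-nonempty {n} P bound with any? (λ w → P w Bool.≟ true)
... | yes (w , pw) = bound w pw
... | no empty     =
  ≤-trans (count-mono P _ (λ w pw → ⊥-elim (empty (w , pw)))) (≤-trans (≤-reflexive (count-false {n})) z≤n)

count-singleton : (x : Fin n) → count (λ v → does (v ≟ x)) ≡ 1
count-singleton {suc n} zero    = cong suc (count-false {n})
count-singleton {suc n} (suc x) = count-singleton x

index : (P : Fin n → Bool) (v : Fin n) → .(P v ≡ true) → Fin (count P)
index P zero    p with P zero
... | true = zero
index P (suc v) p with P zero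
... | true  = suc (index (P ∘ suc) v p)
... | false = index (P ∘ suc) v p

element : (P : Fin n → Bool) → Fin (count P) → Fin n
element {suc n} P i with P zero
element {suc n} P zero    | true = zero
element {suc n} P (suc i) | true = suc (element (P ∘ suc) i)
element {suc n} P i       | false = suc (element (P ∘ suc) i)

element-true : (P : Fin n → Bool) (i : Fin (count P)) → P (element P i) ≡ true
element-true {suc n} P i with P zero in p
element-true {suc n} P zero    | true  = p
element-true {suc n} P (suc i) | true  = element-true (P ∘ suc) i
element-true {suc n} P i       | false = element-true (P ∘ suc) i

element-index : (P : Fin n → Bool) (v : Fin n) .(p : P v ≡ true) → element P (index P v p) ≡ v
element-index P zero    p with P zero
... | true = refl
element-index P (suc v) p with P zero
... | true  = cong suc (element-index (P ∘ suc) v p)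
... | false = cong suc (element-index (P ∘ suc) v p)

element-injective : (P : Fin n → Bool) {i j : Fin (count P)} → element P i ≡ element P j → i ≡ j
element-injective {suc n} P {i} {j} eq with P zero
element-injective {suc n} P {zero}  {zero}  eq    | true = refl
element-injective {suc n} P {suc i} {suc j} eq | true = cong suc (element-injective (P ∘ suc) (suc-injective eq))
element-injective {suc n} P {i}     {j}     eq    | false = element-injective (P ∘ suc) (suc-injective eq)

index-element : (P : Fin n → Bool) (i : Fin (count P)) .(p : P (element P i) ≡ true) → index P (element P i) p ≡ i
index-element P i p = element-injective P (element-index P (element P i) p)

index-cong : (P : Fin n → Bool) {u v : Fin n} .{p : P u ≡ true} .{q : P v ≡ true} →
             u ≡ v → index P u p ≡ index P v q
index-cong P refl = refl

index-injective : (P : Fin n → Bool) {u v : Fin n} .(p : P u ≡ true) .(q : P v ≡ true) →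
                  index P u p ≡ index P v q → u ≡ v
index-injective P {u} {v} p q eq =
  trans (sym (element-index P u p)) (trans (cong (element P) eq) (element-index P v q))

count-of-section : ∀ {c} (P : Fin n → Bool) (r : Fin c → Fin n) (π : Fin n → Fin c) →
                   (∀ i → π (r i) ≡ i) → (∀ i → P (r i) ≡ true) → (∀ v → P v ≡ true → r (π v) ≡ v) →
                   count P ≡ c
count-of-section P r π πr≡id P-r r-π =
  ≤-antisym (injective⇒≤ π∘element-injective) (injective⇒≤ index∘r-injective)
  where
  open ≡-Reasoning
  π∘element-injective : ∀ {a b} → π (element P a) ≡ π (element P b) → a ≡ b
  π∘element-injective {a} {b} eq = element-injective P (begin
    element P a           ≡⟨ sym (r-π _ (element-true P a)) ⟩
    r (π (element P a))   ≡⟨ cong r eq ⟩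
    r (π (element P b))   ≡⟨ r-π _ (element-true P b) ⟩
    element P b           ∎)
  index∘r-injective : ∀ {i j} → index P (r i) (P-r i) ≡ index P (r j) (P-r j) → i ≡ j
  index∘r-injective {i} {j} eq = begin
    i          ≡⟨ sym (πr≡id i) ⟩
    π (r i)    ≡⟨ cong π (index-injective P (P-r i) (P-r j) eq) ⟩
    π (r j)    ≡⟨ πr≡id j ⟩
    j          ∎

least-witness : {P : ℕ → Set} → Decidable P → ∀ {m} → P m → ∃ (IsMinOf P)
least-witness {P} P? {m} pm with below (suc m)
  where
  below : ∀ b → ∃ (IsMinOf P) ⊎ (∀ x → x < b → ¬ P x)
  below zero = inj₂ (λ _ ())
  below (suc b) with below b | P? b
  ... | inj₁ found | _      = inj₁ found
  ... | inj₂ none  | yes pb = inj₁ (b , pb , λ x px → ≮⇒≥ (λ x<b → none x x<b px))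
  ... | inj₂ none  | no ¬pb = inj₂ λ x x<1+b px → case m≤n⇒m<n∨m≡n (s≤s⁻¹ x<1+b) of λ where
    (inj₁ x<b)  → none x x<b px
    (inj₂ refl) → ¬pb px
... | inj₁ found = found
... | inj₂ none  = ⊥-elim (none m ≤-refl pm)

any-predicate? : {P : (Fin n → Bool) → Set} →
                 (∀ {f g} → f ≗ g → P f → P g) → (∀ f → Dec (P f)) → Dec (∃ P)
any-predicate? resp P? =
  map′ (λ (s , ps) → lookup s , ps) (λ (f , pf) → tabulate f , resp (sym ∘ lookup∘tabulate f) pf)
       (anySubset? (P? ∘ lookup))

any-relation? : {P : (Fin n → Fin n → Bool) → Set} →
                (∀ {o o′} → (∀ u v → o u v ≡ o′ u v) → P o → P o′) → (∀ o → Dec (P o)) → Dec (∃ P)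
any-relation? {n} resp P? =
  map′ (λ (f , pf) → uncurried f , pf)
       (λ (o , po) → (λ i → uncurry o (remQuot n i)) , resp (λ u v → cong (uncurry o) (sym (remQuot-combine u v))) po)
       (any-predicate? (λ f≗g → resp (λ u v → f≗g (combine u v))) (P? ∘ uncurried))
  where
  uncurried : (Fin (n * n) → Bool) → Fin n → Fin n → Bool
  uncurried f u v = f (combine u v)

module _ (f : (Fin n → Bool) → Fin n → Bool) (inflationary : ∀ X → X ⊆ f X) where

  iterate-mono : ∀ S {i j} → i ≤ j → iterate f i S ⊆ iterate f j S
  iterate-mono S {i} {j} i≤j with m≤n⇒m<n∨m≡n i≤j
  ... | inj₂ refl = λ _ p → p
  iterate-mono S {i} {suc j} _ | inj₁ i<1+j = λ v p → inflationary _ v (iterate-mono S (s≤s⁻¹ i<1+j) v p)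

  module _ (f-cong : ∀ {X Y} → X ≗ Y → f X ≗ f Y) where

    iterate-from-fixed : ∀ S {j} → f (iterate f j S) ≗ iterate f j S →
                         ∀ {i} → j ≤ i → iterate f i S ≗ iterate f j S
    iterate-from-fixed S {j} fixed {i} j≤i with m≤n⇒m<n∨m≡n j≤i
    ... | inj₂ refl = λ _ → refl
    iterate-from-fixed S {j} fixed {suc i} _ | inj₁ j<1+i =
      λ v → trans (f-cong (iterate-from-fixed S fixed (s≤s⁻¹ j<1+i)) v) (fixed v)

    fixed-or-grown : ∀ S j → (∃[ i ] i ≤ j × f (iterate f i S) ≗ iterate f i S) ⊎ j ≤ count (iterate f j S)
    fixed-or-grown S zero = inj₂ z≤n
    fixed-or-grown S (suc j) with fixed-or-grown S j
    ... | inj₁ (i , i≤j , fixed) = inj₁ (i , ≤-trans i≤j (n≤1+n j) , fixed)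
    ... | inj₂ j≤count with any? (λ v → (X v Bool.≟ false) ×-dec (f X v Bool.≟ true))
      where X = iterate f j S
    ...   | yes (v , new , coloured) = inj₂ (≤-trans (s≤s j≤count) (count-< _ _ (inflationary _) v new coloured))
    ...   | no nothing-new = inj₁ (j , n≤1+n j , fixed)
      where
      fixed : f (iterate f j S) ≗ iterate f j S
      fixed v with iterate f j S v in x
      ... | true = inflationary _ v x
      ... | false with f (iterate f j S) v in fx
      ...   | false = refl
      ...   | true  = ⊥-elim (nothing-new (v , x , fx))

    iterate-stable : ∀ S m → iterate f m S ⊆ iterate f n S
    iterate-stable S m with fixed-or-grown S n
    ... | inj₂ n≤count = λ v _ → count-full _ n≤count v
    ... | inj₁ (j , j≤n , fixed) with ≤-total m n
    ...   | inj₁ m≤n = iterate-mono S m≤n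
    ...   | inj₂ n≤m = λ v p → trans (iterate-from-fixed S fixed j≤n v)
                                (trans (sym (iterate-from-fixed S fixed (≤-trans j≤n n≤m) v)) p)

anyFin-intro : (P : Fin n → Bool) (u : Fin n) → P u ≡ true → anyFin P ≡ true
anyFin-intro P zero    p = ∨-trueˡ _ p
anyFin-intro P (suc u) p = ∨-trueʳ (P zero) (anyFin-intro (P ∘ suc) u p)

anyFin-elim : (P : Fin n → Bool) → anyFin P ≡ true → ∃[ u ] P u ≡ true
anyFin-elim {suc n} P p with ∨-true⁻ (P zero) p
... | inj₁ p₀ = zero , p₀
... | inj₂ p₊ with anyFin-elim (P ∘ suc) p₊
...   | u , pu = suc u , pu

anyFin-cong : {P Q : Fin n → Bool} → P ≗ Q → anyFin P ≡ anyFin Q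
anyFin-cong {zero}  P≗Q = refl
anyFin-cong {suc n} P≗Q = cong₂ _∨_ (P≗Q zero) (anyFin-cong (P≗Q ∘ suc))

-- The k-color change rule `step k D` is definitionally `spread (forcesAt k D)`.
spread : ((Fin n → Bool) → Fin n → Fin n → Bool) → (Fin n → Bool) → Fin n → Bool
spread Φ X v = X v ∨ anyFin (λ u → Φ X u v)

spread-inflationary : ∀ Φ (X : Fin n → Bool) → X ⊆ spread Φ X
spread-inflationary Φ X v = ∨-trueˡ _

spread-spreads : ∀ Φ (X : Fin n → Bool) {u v} → Φ X u v ≡ true → spread Φ X v ≡ true
spread-spreads Φ X {u} φ = ∨-trueʳ (X _) (anyFin-intro _ u φ)

spread-colours : ∀ Φ (X : Fin n → Bool) {u v} → (X v ≡ false → Φ X u v ≡ true) → spread Φ X v ≡ true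
spread-colours Φ X {u} {v} φ with X v
... | true  = refl
... | false = anyFin-intro _ u (φ refl)

module FirstArrival (Φ : (Fin n → Bool) → Fin n → Fin n → Bool) (S : Fin n → Bool)
  (Φ-source : ∀ X u v → Φ X u v ≡ true → X u ≡ true)
  (reaches : ∀ v → ∃[ m ] iterate (spread Φ) m S v ≡ true) where

  reached : ℕ → Fin n → Bool
  reached j = iterate (spread Φ) j S

  private
    first : ∀ v → ∃ (IsMinOf (λ j → reached j v ≡ true))
    first v = least-witness (λ j → reached j v Bool.≟ true) {proj₁ (reaches v)} (proj₂ (reaches v))

  arrival : Fin n → ℕ
  arrival v = proj₁ (first v)

  arrival-reached : ∀ v → reached (arrival v) v ≡ true
  arrival-reached v = proj₁ (proj₂ (first v))

  arrival-least : ∀ v j → reached j v ≡ true → arrival v ≤ j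
  arrival-least v = proj₂ (proj₂ (first v))

  arrival-source : ∀ v → S v ≡ false → ∃[ u ] ∃[ a ] arrival v ≡ suc a × Φ (reached a) u v ≡ true
  arrival-source v sv with arrival v in eq | arrival-reached v
  ... | zero  | r = ⊥-elim (true≢false r sv)
  ... | suc a | r with ∨-true⁻ (reached a v) r
  ...   | inj₁ early = ⊥-elim (<-irrefl refl (≤-trans (≤-reflexive (sym eq)) (arrival-least v a early)))
  ...   | inj₂ late  = let u , φ = anyFin-elim _ late in u , a , refl , φ

  private
    parent-of : ∀ v b → S v ≡ b → Fin n
    parent-of v true  _  = v
    parent-of v false sv = proj₁ (arrival-source v sv)

  parent : Fin n → Fin n
  parent v = parent-of v (S v) refl

  parent-arrival : ∀ v → S v ≡ false → ∃[ a ] arrival v ≡ suc a × Φ (reached a) (parent v) v ≡ true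
  parent-arrival v = spec (S v) refl
    where
    spec : ∀ b (sv : S v ≡ b) → b ≡ false → ∃[ a ] arrival v ≡ suc a × Φ (reached a) (parent-of v b sv) v ≡ true
    spec false sv _ = proj₂ (arrival-source v sv)

  parent-earlier : ∀ v → S v ≡ false → arrival (parent v) < arrival v
  parent-earlier v sv with parent-arrival v sv
  ... | a , eq , φ = ≤-trans (s≤s (arrival-least _ a (Φ-source _ _ _ φ))) (≤-reflexive (sym eq))

  grandparent≢ : ∀ v → S v ≡ false → S (parent v) ≡ false → parent (parent v) ≢ v
  grandparent≢ v sv spv eq =
    <-asym (parent-earlier v sv) (subst (λ w → arrival w < arrival (parent v)) eq (parent-earlier (parent v) spv))

walk-++ : {E : Fin n → Fin n → Bool} {u v w : Fin n} → Walk E u v → Walk E v w → Walk E u w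
walk-++ here        q = q
walk-++ (there e p) q = there e (walk-++ p q)

walk-reverse : {E : Fin n → Fin n → Bool} → (∀ u v → E u v ≡ E v u) → {u v : Fin n} → Walk E u v → Walk E v u
walk-reverse E-sym here = here
walk-reverse E-sym {u} (there {w = w} e p) = walk-++ (walk-reverse E-sym p) (there (trans (E-sym w u) e) here)

argmax : ∀ {m} (f : Fin (suc m) → ℕ) → ∃[ a ] (∀ b → f b ≤ f a)
argmax {zero}  f = zero , λ { zero → ≤-refl }
argmax {suc m} f with argmax (f ∘ suc)
... | a , max with ≤-total (f zero) (f (suc a))
...   | inj₁ f₀≤ = suc a , λ { zero → f₀≤ ; (suc b) → max b }
...   | inj₂ ≤f₀ = zero , λ { zero → ≤-refl ; (suc b) → ≤-trans (max b) ≤f₀ }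

Linked : ∀ {m} (E : Fin n → Fin n → Bool) (c : Fin m → Fin n) → Fin m → Fin m → Set
Linked E c a b = E (c a) (c b) ≡ true ⊎ E (c b) (c a) ≡ true

module _ {E : Fin n → Fin n → Bool} {m : ℕ} (c : Fin (3 + m) → Fin n)
  (consecutive : ∀ (i : Fin (2 + m)) → E (c (inject₁ i)) (c (suc i)) ≡ true)
  (closing : E (c (fromℕ (2 + m))) (c zero) ≡ true) where

  cycle-neighbours : ∀ a → ∃₂ λ b b′ → b ≢ b′ × Linked E c a b × Linked E c a b′
  cycle-neighbours zero = suc zero , fromℕ (2 + m) , (λ ()) , inj₁ (consecutive zero) , inj₂ closing
  cycle-neighbours (suc j) with view j
  ... | ‵fromℕ = inject₁ (fromℕ (1 + m)) , zero , (λ ()) , inj₂ (consecutive (fromℕ (1 + m))) , inj₁ closing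
  ... | ‵inject₁ j′ =
    inject₁ (inject₁ j′) , suc (suc j′) , distinct , inj₂ (consecutive (inject₁ j′)) , inj₁ (consecutive (suc j′))
    where
    distinct : inject₁ (inject₁ j′) ≢ suc (suc j′)
    distinct eq = <-irrefl (trans (sym (trans (toℕ-inject₁ (inject₁ j′)) (toℕ-inject₁ j′))) (cong toℕ eq))
                           (s≤s (n≤1+n _))

-- On each edge one endpoint is the parent of the other and has smaller rank,
-- so the top-ranked vertex of a cycle would have both cycle neighbours as parent.
ranked-acyclic : (E : Fin n → Fin n → Bool) (rank : Fin n → ℕ) (parent : Fin n → Fin n) →
                 (∀ u v → E u v ≡ true → (rank u < rank v × parent v ≡ u) ⊎ (rank v < rank u × parent u ≡ v)) →
                 ¬ HasCycle E
ranked-acyclic E rank parent ranked (m , c , c-injective , consecutive , closing)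
  with a , top ← argmax (rank ∘ c)
  with b , b′ , b≢b′ , ab , ab′ ← cycle-neighbours {E = E} c consecutive closing a
  = b≢b′ (c-injective (trans (sym (parent-is ab)) (parent-is ab′)))
  where
  parent-is : ∀ {b} → Linked E c a b → parent (c a) ≡ c b
  parent-is {b} (inj₁ e) with ranked (c a) (c b) e
  ... | inj₁ (lt , _) = ⊥-elim (<-irrefl refl (≤-trans lt (top b)))
  ... | inj₂ (_ , eq) = eq
  parent-is {b} (inj₂ e) with ranked (c b) (c a) e
  ... | inj₁ (_ , eq) = eq
  ... | inj₂ (lt , _) = ⊥-elim (<-irrefl refl (≤-trans lt (top b)))

module NonBacktrackingWalk (E : Fin n → Fin n → Bool) (V : Fin n → Bool)
  (irreflexive : ∀ v → E v v ≡ false) (closed : ∀ u v → E u v ≡ true → V v ≡ true)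
  (branching : ∀ v → V v ≡ true → 2 ≤ count (E v)) (v₀ : Fin n) (v₀∈V : V v₀ ≡ true) where

  Onward : Fin n → Fin n → Fin n → Set
  Onward prev cur w = E cur w ≡ true × w ≢ prev

  private
    onward? : ∀ prev cur → Dec (∃ (Onward prev cur))
    onward? prev cur = any? (λ w → (E cur w Bool.≟ true) ×-dec ¬? (w ≟ prev))

    pick : ∀ {prev cur} → Dec (∃ (Onward prev cur)) → Fin n
    pick (yes (w , _)) = w
    pick {cur = cur} (no _)        = cur

  next : Fin n → Fin n → Fin n
  next prev cur = pick (onward? prev cur)

  next-onward : ∀ prev cur → V cur ≡ true → Onward prev cur (next prev cur)
  next-onward prev cur cur∈V with onward? prev cur
  ... | yes (_ , onward) = onward
  ... | no stuck = ⊥-elim (<-irrefl refl (≤-trans (branching cur cur∈V)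
                                                  (≤-trans (count-mono _ _ only-prev) (≤-reflexive (count-singleton prev)))))
    where
    only-prev : E cur ⊆ (λ w → does (w ≟ prev))
    only-prev w e = dec-true (w ≟ prev) (decidable-stable (w ≟ prev) (λ w≢prev → stuck (w , e , w≢prev)))

  x : ℕ → Fin n
  x zero          = v₀
  x (suc zero)    = next v₀ v₀
  x (suc (suc t)) = next (x t) (x (suc t))

  x∈V  : ∀ t → V (x t) ≡ true
  edge : ∀ t → E (x t) (x (suc t)) ≡ true
  x∈V zero    = v₀∈V
  x∈V (suc t) = closed _ _ (edge t)
  edge zero    = proj₁ (next-onward v₀ v₀ v₀∈V)
  edge (suc t) = proj₁ (next-onward (x t) (x (suc t)) (x∈V (suc t)))

  no-backtrack : ∀ t → x (suc (suc t)) ≢ x t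
  no-backtrack t = proj₂ (next-onward (x t) (x (suc t)) (x∈V (suc t)))

  simple-return⇒cycle : ∀ a m → (∀ {i j : Fin (3 + m)} → x (a + toℕ i) ≡ x (a + toℕ j) → i ≡ j) →
                        x a ≡ x (a + (3 + m)) → HasCycle E
  simple-return⇒cycle a m simple return = m , (λ i → x (a + toℕ i)) , simple , consecutive , closing
    where
    consecutive : ∀ (i : Fin (2 + m)) → E (x (a + toℕ (inject₁ i))) (x (a + suc (toℕ i))) ≡ true
    consecutive i rewrite toℕ-inject₁ i | +-suc a (toℕ i) = edge (a + toℕ i)
    closing : E (x (a + toℕ (fromℕ (2 + m)))) (x (a + 0)) ≡ true
    closing rewrite toℕ-fromℕ (2 + m) | +-identityʳ a =
      subst (λ w → E (x (a + (2 + m))) w ≡ true) (trans (cong x (sym (+-suc a (2 + m)))) (sym return)) (edge (a + (2 + m)))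

  -- A return x a ≡ x (a + L) either contains a shorter return or is a simple
  -- closed walk, which cannot have length 1 (no loops) or 2 (no backtracking).
  return⇒cycle : ∀ a L → Acc _<_ L → 0 < L → x a ≡ x (a + L) → HasCycle E
  return⇒cycle a L (acc shorter) 0<L return
    with any? (λ j → any? (λ i → (i Fin.<? j) ×-dec (x (a + toℕ i) ≟ x (a + toℕ j))))
  ... | yes (j , i , i<j , eq) =
    return⇒cycle (a + toℕ i) (toℕ j ∸ toℕ i) (shorter (≤-<-trans (m∸n≤m (toℕ j) (toℕ i)) (toℕ<n j))) (m<n⇒0<n∸m i<j)
                 (trans eq (cong x (sym (trans (+-assoc a (toℕ i) _) (cong (a +_) (m+[n∸m]≡n (<⇒≤ i<j)))))))
  ... | no no-inner-return = simple-return L 0<L simple return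
    where
    simple : ∀ {i j : Fin L} → x (a + toℕ i) ≡ x (a + toℕ j) → i ≡ j
    simple {i} {j} eq with <-cmp i j
    ... | tri< i<j _ _ = ⊥-elim (no-inner-return (j , i , i<j , eq))
    ... | tri≈ _ i≡j _ = i≡j
    ... | tri> _ _ j<i = ⊥-elim (no-inner-return (i , j , j<i , sym eq))
    simple-return : ∀ L → 0 < L → (∀ {i j : Fin L} → x (a + toℕ i) ≡ x (a + toℕ j) → i ≡ j) →
                    x a ≡ x (a + L) → HasCycle E
    simple-return 1 _ _ return =
      ⊥-elim (true≢false (subst (λ w → E (x a) w ≡ true) (trans (cong x (+-comm 1 a)) (sym return)) (edge a)) (irreflexive (x a)))
    simple-return 2 _ _ return = ⊥-elim (no-backtrack a (trans (cong x (+-comm 2 a)) (sym return)))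
    simple-return (suc (suc (suc m))) _ simple return = simple-return⇒cycle a m simple return

  cycle : HasCycle E
  cycle with i , j , i<j , eq ← pigeonhole (n<1+n n) (x ∘ toℕ) =
    return⇒cycle (toℕ i) (toℕ j ∸ toℕ i) (<-wellFounded _) (m<n⇒0<n∸m i<j)
                 (trans eq (cong x (sym (m+[n∸m]≡n (<⇒≤ i<j)))))

leaf-exists : (E : Fin n → Fin n → Bool) (V : Fin n → Bool) → (∀ v → E v v ≡ false) →
              (∀ u v → E u v ≡ true → V v ≡ true) → ¬ HasCycle E → ∃[ v ] V v ≡ true →
              ∃[ v ] V v ≡ true × count (E v) ≤ 1
leaf-exists E V irreflexive closed acyclic (v₀ , v₀∈V) with any? (λ v → (V v Bool.≟ true) ×-dec (count (E v) ≤? 1))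
... | yes leaf = leaf
... | no no-leaf = ⊥-elim (acyclic (NonBacktrackingWalk.cycle E V irreflexive closed branching v₀ v₀∈V))
  where
  branching : ∀ v → V v ≡ true → 2 ≤ count (E v)
  branching v v∈V = ≰⇒> (λ ≤1 → no-leaf (v , v∈V , ≤1))

-- A spanning forest given by parent pointers; `rank` decreases towards the
-- roots, which rules out cycles.
record RootedForest (G : Graph n) (k : ℕ) (root : Fin n → Bool) : Set where
  field
    parent      : Fin n → Fin n
    rank        : Fin n → ℕ
    parent-adj  : ∀ v → root v ≡ false → adj G (parent v) v ≡ true
    parent-rank : ∀ v → root v ≡ false → rank (parent v) < rank v

  isChild : Fin n → Fin n → Bool
  isChild u v = not (root v) ∧ does (parent v ≟ u)

  field
    children-≤ : ∀ u → count (isChild u) ≤ k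

  isChild-intro : ∀ v → root v ≡ false → isChild (parent v) v ≡ true
  isChild-intro v nr = ∧-true (cong not nr) (dec-true (parent v ≟ parent v) refl)

  isChild-elim : ∀ {u v} → isChild u v ≡ true → root v ≡ false × parent v ≡ u
  isChild-elim {u} {v} c = let nr , p = ∧-true⁻ (not (root v)) c in not-true⁻ nr , from-does (parent v ≟ u) p

  climb : ℕ → Fin n → Fin n
  climb zero    x = x
  climb (suc j) x = if root x then x else climb j (parent x)

  climb-root : ∀ j {x} → root x ≡ true → climb j x ≡ x
  climb-root zero    r = refl
  climb-root (suc j) r rewrite r = refl

  climb-step : ∀ j {x} → root x ≡ false → climb (suc j) x ≡ climb j (parent x)
  climb-step j r rewrite r = refl

  climb-settles : ∀ j x → rank x ≤ j → root (climb j x) ≡ true × climb (suc j) x ≡ climb j x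
  climb-settles j x rank≤j with root x in r
  ... | true = subst (λ y → root y ≡ true) (sym (climb-root j r)) r , sym (climb-root j r)
  climb-settles zero x rank≤0 | false = ⊥-elim (n≮0 (≤-trans (parent-rank x r) rank≤0))
  climb-settles (suc j) x rank≤1+j | false rewrite r =
    climb-settles j (parent x) (s≤s⁻¹ (≤-trans (parent-rank x r) rank≤1+j))

  climb-stable : ∀ x {i j} → rank x ≤ i → i ≤ j → climb j x ≡ climb i x
  climb-stable x {i} {j} rank≤i i≤j with m≤n⇒m<n∨m≡n i≤j
  ... | inj₂ refl = refl
  climb-stable x {i} {suc j} rank≤i _ | inj₁ i<1+j =
    trans (proj₂ (climb-settles j x (≤-trans rank≤i i≤j′))) (climb-stable x rank≤i i≤j′)
    where i≤j′ = s≤s⁻¹ i<1+j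

  rootOf : Fin n → Fin n
  rootOf x = climb (rank x) x

  rootOf-root : ∀ x → root (rootOf x) ≡ true
  rootOf-root x = proj₁ (climb-settles (rank x) x ≤-refl)

  rootOf-of-root : ∀ {x} → root x ≡ true → rootOf x ≡ x
  rootOf-of-root {x} = climb-root (rank x)

  rootOf-parent : ∀ x → root x ≡ false → rootOf (parent x) ≡ rootOf x
  rootOf-parent x nr with rank x | parent-rank x nr
  ... | suc r | s≤s rank≤r rewrite nr = sym (climb-stable (parent x) ≤-refl rank≤r)

module _ {G : Graph n} {k : ℕ} {root : Fin n → Bool} (F : RootedForest G k root) where
  open RootedForest F

  treeOf : Fin n → Fin (count root)
  treeOf v = index root (rootOf v) (rootOf-root v)

  treeOf-child : ∀ {u v} → isChild u v ≡ true → treeOf u ≡ treeOf v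
  treeOf-child {u} {v} c with isChild-elim c
  ... | nr , refl = index-cong root (rootOf-parent v nr)

  treeEdge : Fin (count root) → Fin n → Fin n → Bool
  treeEdge i u v = does (treeOf u ≟ i) ∧ (isChild u v ∨ isChild v u)

  treeEdge⁻ : ∀ {i u v} → treeEdge i u v ≡ true → treeOf u ≡ i × (isChild u v ≡ true ⊎ isChild v u ≡ true)
  treeEdge⁻ {i} {u} {v} e = let u∈i , linked = ∧-true⁻ (does (treeOf u ≟ i)) e in
    from-does (treeOf u ≟ i) u∈i , ∨-true⁻ (isChild u v) linked

  treeOf-linked : ∀ {u v} → isChild u v ≡ true ⊎ isChild v u ≡ true → treeOf u ≡ treeOf v
  treeOf-linked (inj₁ c) = treeOf-child c
  treeOf-linked (inj₂ c) = sym (treeOf-child c)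

  treeEdge-sym : ∀ i u v → treeEdge i u v ≡ treeEdge i v u
  treeEdge-sym i u v rewrite ∨-comm (isChild v u) (isChild u v) with isChild u v ∨ isChild v u in linked
  ... | false = trans (∧-zeroʳ _) (sym (∧-zeroʳ _))
  ... | true  = cong (λ t → does (t ≟ i) ∧ true) (treeOf-linked (∨-true⁻ (isChild u v) linked))

  walk-to-climb : ∀ i j x → treeOf x ≡ i → Walk (treeEdge i) x (climb j x)
  walk-to-climb i zero    x _ = here
  walk-to-climb i (suc j) x x∈i = by-root (root x) refl
    where
    by-root : ∀ b → root x ≡ b → Walk (treeEdge i) x (climb (suc j) x)
    by-root true  r = subst (Walk (treeEdge i) x) (sym (climb-root (suc j) r)) here
    by-root false r = subst (Walk (treeEdge i) x) (sym (climb-step j r))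
      (there (∧-true (dec-true (treeOf x ≟ i) x∈i) (∨-trueʳ (isChild x (parent x)) (isChild-intro x r)))
             (walk-to-climb i j (parent x) (trans (treeOf-child (isChild-intro x r)) x∈i)))

  tree-connected : ∀ i u v → treeOf u ≡ i → treeOf v ≡ i → Walk (treeEdge i) u v
  tree-connected i u v u∈i v∈i =
    walk-++ (walk-to-climb i (rank u) u u∈i)
            (subst (λ w → Walk (treeEdge i) w v) (sym same-root)
                   (walk-reverse (treeEdge-sym i) (walk-to-climb i (rank v) v v∈i)))
    where
    same-root : rootOf u ≡ rootOf v
    same-root = index-injective root (rootOf-root u) (rootOf-root v) (trans u∈i (sym v∈i))

  tree-acyclic : ∀ i → ¬ HasCycle (treeEdge i)
  tree-acyclic i = ranked-acyclic (treeEdge i) rank parent ranked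
    where
    ranked : ∀ u v → treeEdge i u v ≡ true → (rank u < rank v × parent v ≡ u) ⊎ (rank v < rank u × parent u ≡ v)
    ranked u v e with proj₂ (treeEdge⁻ e)
    ... | inj₁ c = let nr , eq = isChild-elim c in inj₁ (subst (λ w → rank w < rank v) eq (parent-rank v nr) , eq)
    ... | inj₂ c = let nr , eq = isChild-elim c in inj₂ (subst (λ w → rank w < rank u) eq (parent-rank u nr) , eq)

  tree-degree : ∀ i v → count (treeEdge i v) ≤ suc k
  tree-degree i v = begin
    count (treeEdge i v)                                    ≤⟨ count-mono _ _ children-or-parent ⟩
    count (λ w → isChild v w ∨ does (w ≟ parent v))         ≤⟨ count-∨ (isChild v) _ ⟩
    count (isChild v) + count (λ w → does (w ≟ parent v))   ≤⟨ +-mono-≤ (children-≤ v) (≤-reflexive (count-singleton (parent v))) ⟩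
    k + 1                                                   ≡⟨ +-comm k 1 ⟩
    suc k                                                   ∎
    where
    open ≤-Reasoning
    children-or-parent : treeEdge i v ⊆ (λ w → isChild v w ∨ does (w ≟ parent v))
    children-or-parent w e with proj₂ (treeEdge⁻ e)
    ... | inj₁ c = ∨-trueˡ _ c
    ... | inj₂ c = ∨-trueʳ (isChild v w) (dec-true (w ≟ parent v) (sym (proj₂ (isChild-elim c))))

  element-treeOf : ∀ i → treeOf (element root i) ≡ i
  element-treeOf i = trans (index-cong root (rootOf-of-root (element-true root i))) (index-element root i (element-true root i))

  forest-cover : TreeCover G k (count root)
  forest-cover = record
    { part     = treeOf
    ; edges    = treeEdge
    ; subgraph = λ i → edge-adj i , treeEdge-sym i , edge-ends i
    ; ktree    = λ i → ((element root i , dec-true (treeOf _ ≟ i) (element-treeOf i))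
                        , (λ u v u∈i v∈i → tree-connected i u v (from-does (treeOf u ≟ i) u∈i)
                                                                 (from-does (treeOf v ≟ i) v∈i))
                        , tree-acyclic i)
                       , λ v _ → tree-degree i v
    }
    where
    edge-adj : ∀ i u v → treeEdge i u v ≡ true → adj G u v ≡ true
    edge-adj i u v e with proj₂ (treeEdge⁻ e)
    ... | inj₁ c = let nr , eq = isChild-elim c in subst (λ w → adj G w v ≡ true) eq (parent-adj v nr)
    ... | inj₂ c = let nr , eq = isChild-elim c in trans (symm G u v) (subst (λ w → adj G w u ≡ true) eq (parent-adj u nr))
    edge-ends : ∀ i u v → treeEdge i u v ≡ true → does (treeOf u ≟ i) ≡ true × does (treeOf v ≟ i) ≡ true
    edge-ends i u v e = let u∈i , linked = treeEdge⁻ e in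
      dec-true (treeOf u ≟ i) u∈i , dec-true (treeOf v ≟ i) (trans (sym (treeOf-linked linked)) u∈i)

-- The forest of a forcing process

forcesAt : ∀ {G : Graph n} → ℕ → Orientation G → (Fin n → Bool) → Fin n → Fin n → Bool
forcesAt k D C u v = canForce k D C u ∧ uncoloredOut D C u v

out-adj : ∀ {G : Graph n} (D : Orientation G) {u v} → out D u v ≡ true → adj G u v ≡ true
out-adj D {u} {v} o = trans (sym (covers D u v)) (∨-trueˡ (out D v u) o)

forcesAt⁻ : ∀ {G : Graph n} {k} (D : Orientation G) C {u v} → forcesAt k D C u v ≡ true →
            C u ≡ true × count (uncoloredOut D C u) ≤ k × out D u v ≡ true × C v ≡ false
forcesAt⁻ {k = k} D C {u} {v} f with ∧-true⁻ (canForce k D C u) f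
... | cf , uo with ∧-true⁻ (C u) cf | ∧-true⁻ (out D u v) uo
...   | cu , few | arc , cv = cu , from-does (_ ≤? k) few , arc , not-true⁻ cv

forcesAt-intro : ∀ {G : Graph n} {k} (D : Orientation G) C {u v} → C u ≡ true → count (uncoloredOut D C u) ≤ k →
                 out D u v ≡ true → C v ≡ false → forcesAt k D C u v ≡ true
forcesAt-intro {k = k} D C cu few arc cv = ∧-true (∧-true cu (dec-true (_ ≤? k) few)) (∧-true arc (cong not cv))

module _ {G : Graph n} {k : ℕ} (D : Orientation G) {S : Fin n → Bool} (forcing : IsForcingSet k D S) where

  open FirstArrival (forcesAt k D) S (λ C u v f → proj₁ (forcesAt⁻ D C f))
                    (λ v → proj₁ (proj₂ forcing) , proj₂ (proj₂ forcing) v)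

  private
    isChild : Fin n → Fin n → Bool
    isChild u v = not (S v) ∧ does (parent v ≟ u)

    child-arrival : ∀ {u w} → isChild u w ≡ true → ∃[ a ] arrival w ≡ suc a × forcesAt k D (reached a) u w ≡ true
    child-arrival {u} {w} c with ∧-true⁻ (not (S w)) c
    ... | nr , p with from-does (parent w ≟ u) p
    ...   | refl = parent-arrival w (not-true⁻ nr)

    child-arc : ∀ {u w} → isChild u w ≡ true → out D u w ≡ true
    child-arc c = let a , _ , f = child-arrival c in proj₁ (proj₂ (proj₂ (forcesAt⁻ D (reached a) f)))

    uncoloured-before-arrival : ∀ w a → a < arrival w → reached a w ≡ false
    uncoloured-before-arrival w a a<arrival = ≢true⇒false λ r → <-irrefl refl (≤-trans a<arrival (arrival-least w a r))

    -- When u forces one of its children, all its other children are still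
    -- uncoloured out-neighbours, hence forced in the same step.
    siblings-not-earlier : ∀ {u w w′} → isChild u w ≡ true → isChild u w′ ≡ true → ¬ arrival w′ < arrival w
    siblings-not-earlier {u} {w} {w′} c c′ w′<w with a′ , eq′ , f′ ← child-arrival c′ =
      <-irrefl eq′ (≤-trans w′<w (arrival-least w (suc a′) (spread-spreads (forcesAt k D) (reached a′) u-forces-w)))
      where
      u-forces-w : forcesAt k D (reached a′) u w ≡ true
      u-forces-w = let cu , few , _ = forcesAt⁻ D (reached a′) f′ in
        forcesAt-intro D (reached a′) cu few (child-arc c)
                       (uncoloured-before-arrival w a′ (<⇒≤ (subst (_< arrival w) eq′ w′<w)))

    children-≤ : ∀ u → count (isChild u) ≤ k
    children-≤ u = count-≤-when-nonempty (isChild u) λ w₀ c₀ →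
      let a , eq₀ , f₀ = child-arrival c₀ in
      ≤-trans (count-mono _ _ (children-uncoloured c₀ eq₀)) (proj₁ (proj₂ (forcesAt⁻ D (reached a) f₀)))
      where
      children-uncoloured : ∀ {w₀ a} → isChild u w₀ ≡ true → arrival w₀ ≡ suc a →
                            isChild u ⊆ uncoloredOut D (reached a) u
      children-uncoloured c₀ eq₀ w c =
        ∧-true (child-arc c)
               (cong not (uncoloured-before-arrival w _ (≤-trans (≤-reflexive (sym eq₀)) (≮⇒≥ (siblings-not-earlier c₀ c)))))

  forcing-forest : RootedForest G k S
  forcing-forest = record
    { parent      = parent
    ; rank        = arrival
    ; parent-adj  = λ v nr → out-adj D (child-arc (∧-true (cong not nr) (dec-true (parent v ≟ parent v) refl)))
    ; parent-rank = parent-earlier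
    ; children-≤  = children-≤
    }

step-cong : ∀ {G : Graph n} {k} (D D′ : Orientation G) → (∀ u v → out D u v ≡ out D′ u v) →
            ∀ {X Y} → X ≗ Y → step k D X ≗ step k D′ Y
step-cong {k = k} D D′ out≡ {X} {Y} X≗Y v =
  cong₂ _∨_ (X≗Y v) (anyFin-cong λ u → cong₂ _∧_ (canForce≡ u) (uncoloured≡ u v))
  where
  uncoloured≡ : ∀ u → uncoloredOut D X u ≗ uncoloredOut D′ Y u
  uncoloured≡ u w = cong₂ _∧_ (out≡ u w) (cong not (X≗Y w))
  canForce≡ : ∀ u → canForce k D X u ≡ canForce k D′ Y u
  canForce≡ u = cong₂ _∧_ (X≗Y u) (cong (λ c → does (c ≤? k)) (count-cong (uncoloured≡ u)))

iterate-step-cong : ∀ {G : Graph n} {k} (D D′ : Orientation G) → (∀ u v → out D u v ≡ out D′ u v) →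
                    ∀ {X Y} → X ≗ Y → ∀ j → iterate (step k D) j X ≗ iterate (step k D′) j Y
iterate-step-cong D D′ out≡ X≗Y zero    = X≗Y
iterate-step-cong D D′ out≡ X≗Y (suc j) = step-cong D D′ out≡ (iterate-step-cong D D′ out≡ X≗Y j)

forcing-stable : ∀ {G : Graph n} k (D : Orientation G) S m → iterate (step k D) m S ⊆ iterate (step k D) n S
forcing-stable k D = iterate-stable (step k D) (spread-inflationary (forcesAt k D)) (step-cong D D (λ _ _ → refl))

-- Forcing along a rooted forest

module RankOrder (rank : Fin n → ℕ) where
  open StrictTotalOrder (×-strictTotalOrder ℕₚ.<-strictTotalOrder (Finₚ.<-strictTotalOrder n))
    using (_<?_; compare; asym)

  below : Fin n → Fin n → Bool
  below v u = does ((rank v , v) <? (rank u , u))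

  below-rank : ∀ {v u} → below v u ≡ true → rank v ≤ rank u
  below-rank {v} {u} b with from-does ((rank v , v) <? (rank u , u)) b
  ... | inj₁ rank<         = <⇒≤ rank<
  ... | inj₂ (rank≡ , _)   = ≤-reflexive rank≡

  below-total : ∀ {u v} → u ≢ v → below v u ∨ below u v ≡ true
  below-total {u} {v} u≢v = case compare (rank v , v) (rank u , u) of λ where
    (tri< v<u _ _)       → ∨-trueˡ _ (dec-true ((rank v , v) <? (rank u , u)) v<u)
    (tri≈ _ (_ , v≡u) _) → ⊥-elim (u≢v (sym v≡u))
    (tri> _ _ u<v)       → ∨-trueʳ (below v u) (dec-true ((rank u , u) <? (rank v , v)) u<v)

  below-asym : ∀ u v → below v u ∧ below u v ≡ false
  below-asym u v with below v u in vu
  ... | false = refl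
  ... | true  = dec-false ((rank u , u) <? (rank v , v)) (asym (from-does ((rank v , v) <? (rank u , u)) vu))

module _ {G : Graph n} {k : ℕ} {root : Fin n → Bool} (F : RootedForest G k root) where
  open RootedForest F
  open RankOrder rank

  forestArc : Fin n → Fin n → Bool
  forestArc u v = adj G u v ∧ (isChild u v ∨ (not (isChild v u) ∧ below v u))

  private
    not-mutual-children : ∀ u v → isChild u v ≡ true → isChild v u ≡ true → ⊥
    not-mutual-children u v cuv cvu with isChild-elim cuv | isChild-elim cvu
    ... | nv , refl | nu , pu =
      <-asym (parent-rank v nv) (subst (λ w → rank w < rank (parent v)) pu (parent-rank (parent v) nu))

    adj-distinct : ∀ {u v} → adj G u v ≡ true → u ≢ v
    adj-distinct {u} a refl = true≢false a (irrefl G u)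

  forestArc-covers : ∀ u v → forestArc u v ∨ forestArc v u ≡ adj G u v
  forestArc-covers u v rewrite symm G v u with adj G u v in a
  ... | false = refl
  ... | true with isChild u v | isChild v u
  ...   | true  | _     = refl
  ...   | false | true  = refl
  ...   | false | false = below-total (adj-distinct a)

  forestArc-exclusive : ∀ u v → forestArc u v ∧ forestArc v u ≡ false
  forestArc-exclusive u v rewrite symm G v u with adj G u v
  ... | false = refl
  ... | true with isChild u v in cuv | isChild v u in cvu
  ...   | true  | true  = ⊥-elim (not-mutual-children u v cuv cvu)
  ...   | true  | false = refl
  ...   | false | true  = refl
  ...   | false | false = below-asym u v

  forestOrientation : Orientation G
  forestOrientation = record { out = forestArc ; covers = forestArc-covers ; exclusive = forestArc-exclusive }

  forestArc-child : ∀ v → root v ≡ false → forestArc (parent v) v ≡ true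
  forestArc-child v nr = ∧-true (parent-adj v nr) (∨-trueˡ _ (isChild-intro v nr))

  forestArc⁻ : ∀ {u v} → forestArc u v ≡ true → isChild u v ≡ true ⊎ rank v ≤ rank u
  forestArc⁻ {u} {v} a with ∨-true⁻ (isChild u v) (proj₂ (∧-true⁻ (adj G u v) a))
  ... | inj₁ c    = inj₁ c
  ... | inj₂ down = inj₂ (below-rank (proj₂ (∧-true⁻ (not (isChild v u)) down)))

  private
    D : Orientation G
    D = forestOrientation

    coloured : ℕ → Fin n → Bool
    coloured j = iterate (step k D) j root

    coloured-by-rank : ∀ j v → rank v ≤ j → coloured j v ≡ true
    coloured-by-rank zero v rank≤0 with root v in r
    ... | true  = refl
    ... | false = ⊥-elim (n≮0 (≤-trans (parent-rank v r) rank≤0))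
    coloured-by-rank (suc j) v rank≤1+j = by-root (root v) refl
      where
      by-root : ∀ b → root v ≡ b → coloured (suc j) v ≡ true
      by-root true  r = iterate-mono (step k D) (spread-inflationary (forcesAt k D)) root {0} {suc j} z≤n v r
      by-root false r = spread-colours (forcesAt k D) (coloured j) {u}
                          (forcesAt-intro D (coloured j) u-coloured (≤-trans (count-mono _ _ uncoloured-children) (children-≤ u))
                                          (forestArc-child v r))
        where
        u = parent v
        rank-u≤j : rank u ≤ j
        rank-u≤j = s≤s⁻¹ (≤-trans (parent-rank v r) rank≤1+j)
        u-coloured : coloured j u ≡ true
        u-coloured = coloured-by-rank j u rank-u≤j
        -- other out-neighbours of u have rank at most rank u ≤ j, so they are already coloured
        uncoloured-children : uncoloredOut D (coloured j) u ⊆ isChild u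
        uncoloured-children w uo with ∧-true⁻ (forestArc u w) uo
        ... | arc , nc with forestArc⁻ arc
        ...   | inj₁ child = child
        ...   | inj₂ low   = ⊥-elim (true≢false (coloured-by-rank j w (≤-trans low rank-u≤j)) (not-true⁻ nc))

  forest-forcing : Fin n → IsForcingSet k forestOrientation root
  forest-forcing v₀ = (rootOf v₀ , rootOf-root v₀) , n ,
    λ v → forcing-stable k D root (rank v) v (coloured-by-rank (rank v) v ≤-refl)

-- The rooted forest of a tree cover

module _ {G : Graph n} {k : ℕ} (1≤k : 1 ≤ k) {c : ℕ} (TC : TreeCover G k c) where
  open TreeCover TC

  private
    edge-ends : ∀ {i u v} → edges i u v ≡ true → part u ≡ i × part v ≡ i
    edge-ends {i} {u} {v} e = let u∈i , v∈i = proj₂ (proj₂ (subgraph i)) u v e in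
      from-does (part u ≟ i) u∈i , from-does (part v ≟ i) v∈i

    own-tree : ∀ v → vset (part v) v ≡ true
    own-tree v = dec-true (part v ≟ part v) refl

    leaf : ∀ i → ∃[ v ] vset i v ≡ true × count (edges i v) ≤ 1
    leaf i = leaf-exists (edges i) (vset i) irreflexive (λ u v e → proj₂ (proj₂ (proj₂ (subgraph i)) u v e))
                         (proj₂ (proj₂ (proj₁ (ktree i)))) (proj₁ (proj₁ (ktree i)))
      where
      irreflexive : ∀ v → edges i v v ≡ false
      irreflexive v = ≢true⇒false λ e → true≢false (proj₁ (subgraph i) v v e) (irrefl G v)

    leafOf : Fin c → Fin n
    leafOf i = proj₁ (leaf i)

    part-leafOf : ∀ i → part (leafOf i) ≡ i
    part-leafOf i = from-does (part (leafOf i) ≟ i) (proj₁ (proj₂ (leaf i)))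

  leafRoot : Fin n → Bool
  leafRoot v = does (v ≟ leafOf (part v))

  private
    leafRoot-leafOf : ∀ i → leafRoot (leafOf i) ≡ true
    leafRoot-leafOf i = dec-true (leafOf i ≟ leafOf (part (leafOf i))) (cong leafOf (sym (part-leafOf i)))

  count-leafRoot : count leafRoot ≡ c
  count-leafRoot = count-of-section leafRoot leafOf part part-leafOf leafRoot-leafOf
                                    (λ v root → sym (from-does (v ≟ leafOf (part v)) root))

  private
    coverEdge : Fin n → Fin n → Bool
    coverEdge u v = edges (part u) u v

    coverEdge-sym : ∀ {u v} → coverEdge u v ≡ true → coverEdge v u ≡ true
    coverEdge-sym {u} {v} e with edge-ends e
    ... | _ , v∈u = trans (proj₁ (proj₂ (subgraph (part v))) v u) (subst (λ i → edges i u v ≡ true) (sym v∈u) e)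

    root-degree : ∀ {u} → leafRoot u ≡ true → count (coverEdge u) ≤ 1
    root-degree {u} root =
      subst (λ w → count (edges (part u) w) ≤ 1) (sym (from-does (u ≟ leafOf (part u)) root)) (proj₂ (proj₂ (leaf (part u))))

    along : (Fin n → Bool) → Fin n → Fin n → Bool
    along X u v = X u ∧ coverEdge u v

    walk-reaches : ∀ {i x y} → Walk (edges i) x y → ∀ j → iterate (spread along) j leafRoot x ≡ true →
                   ∃[ m ] iterate (spread along) m leafRoot y ≡ true
    walk-reaches here j reached = j , reached
    walk-reaches {i} {x} (there {w = w} e p) j reached =
      walk-reaches p (suc j)
        (spread-spreads along _ {x} (∧-true reached (subst (λ i′ → edges i′ x w ≡ true) (sym (proj₁ (edge-ends e))) e)))

    reaches : ∀ v → ∃[ m ] iterate (spread along) m leafRoot v ≡ true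
    reaches v = walk-reaches tree-walk 0 (leafRoot-leafOf (part v))
      where
      tree-walk : Walk (edges (part v)) (leafOf (part v)) v
      tree-walk = proj₁ (proj₂ (proj₁ (ktree (part v)))) (leafOf (part v)) v (proj₁ (proj₂ (leaf (part v)))) (own-tree v)

  open FirstArrival along leafRoot (λ X u v φ → proj₁ (∧-true⁻ (X u) φ)) reaches

  private
    isChild : Fin n → Fin n → Bool
    isChild u v = not (leafRoot v) ∧ does (parent v ≟ u)

    parent-edge : ∀ v → leafRoot v ≡ false → coverEdge (parent v) v ≡ true
    parent-edge v nr = let a , _ , φ = parent-arrival v nr in proj₂ (∧-true⁻ (reached a (parent v)) φ)

    children-neighbours : ∀ u → isChild u ⊆ coverEdge u
    children-neighbours u v c with ∧-true⁻ (not (leafRoot v)) c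
    ... | nr , p with from-does (parent v ≟ u) p
    ...   | refl = parent-edge v (not-true⁻ nr)

    -- A root is a leaf of its tree; any other vertex has its parent as a neighbour that is not a child.
    children-≤ : ∀ u → count (isChild u) ≤ k
    children-≤ u = by-root (leafRoot u) refl
      where
      by-root : ∀ b → leafRoot u ≡ b → count (isChild u) ≤ k
      by-root true  root = ≤-trans (count-mono _ _ (children-neighbours u)) (≤-trans (root-degree root) 1≤k)
      by-root false nr   = s≤s⁻¹ (≤-trans (count-< _ _ (children-neighbours u) (parent u) parent-not-child parent-neighbour)
                                          (proj₂ (ktree (part u)) u (own-tree u)))
        where
        parent-neighbour : coverEdge u (parent u) ≡ true
        parent-neighbour = coverEdge-sym (parent-edge u nr)
        parent-not-child : isChild u (parent u) ≡ false
        parent-not-child = ≢true⇒false λ c → let np , p = ∧-true⁻ (not (leafRoot (parent u))) c in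
          grandparent≢ u nr (not-true⁻ np) (from-does (parent (parent u) ≟ u) p)

  cover-forest : RootedForest G k leafRoot
  cover-forest = record
    { parent      = parent
    ; rank        = arrival
    ; parent-adj  = λ v nr → proj₁ (subgraph (part (parent v))) (parent v) v (parent-edge v nr)
    ; parent-rank = parent-earlier
    ; children-≤  = children-≤
    }

IsForcingSet-cong : ∀ {G : Graph n} {k} (D D′ : Orientation G) {S S′} →
                    (∀ u v → out D u v ≡ out D′ u v) → S ≗ S′ → IsForcingSet k D S → IsForcingSet k D′ S′
IsForcingSet-cong D D′ out≡ S≗S′ ((v , sv) , m , full) =
  (v , trans (sym (S≗S′ v)) sv) , m , λ w → trans (sym (iterate-step-cong D D′ out≡ S≗S′ m w)) (full w)

IsForcingSet? : ∀ {G : Graph n} k (D : Orientation G) S → Dec (IsForcingSet k D S)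
IsForcingSet? {n} k D S =
  map′ (λ (nonempty , full) → nonempty , n , full)
       (λ (nonempty , m , full) → nonempty , λ v → forcing-stable k D S m v (full v))
       (any? (λ v → S v Bool.≟ true) ×-dec all? (λ v → iterate (step k D) n S v Bool.≟ true))

any-orientation? : ∀ {G : Graph n} {P : Orientation G → Set} →
                   (∀ {D D′} → (∀ u v → out D u v ≡ out D′ u v) → P D → P D′) → (∀ D → Dec (P D)) → Dec (∃ P)
any-orientation? {G = G} {P} resp P? =
  map′ (λ (o , cv , ex , p) → orientation o cv ex , p) from-orientation
       (any-relation? {P = IsOrientationWith} resp′ IsOrientationWith?)
  where
  Covers Exclusive : (Fin _ → Fin _ → Bool) → Set
  Covers o    = ∀ u v → o u v ∨ o v u ≡ adj G u v
  Exclusive o = ∀ u v → o u v ∧ o v u ≡ false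
  orientation : ∀ o → Covers o → Exclusive o → Orientation G
  orientation o cv ex = record { out = o ; covers = cv ; exclusive = ex }
  IsOrientationWith : (Fin _ → Fin _ → Bool) → Set
  IsOrientationWith o = Σ (Covers o) λ cv → Σ (Exclusive o) λ ex → P (orientation o cv ex)
  resp′ : ∀ {o o′} → (∀ u v → o u v ≡ o′ u v) → IsOrientationWith o → IsOrientationWith o′
  resp′ o≡ (cv , ex , p) = (λ u v → trans (sym (cong₂ _∨_ (o≡ u v) (o≡ v u))) (cv u v))
                         , (λ u v → trans (sym (cong₂ _∧_ (o≡ u v) (o≡ v u))) (ex u v))
                         , resp o≡ p
  from-orientation : ∃ P → ∃ IsOrientationWith
  from-orientation (D , p) = out D , covers D , exclusive D , p
  IsOrientationWith? : ∀ o → Dec (IsOrientationWith o)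
  IsOrientationWith? o with all? (λ u → all? (λ v → (o u v ∨ o v u) Bool.≟ adj G u v))
                          | all? (λ u → all? (λ v → (o u v ∧ o v u) Bool.≟ false))
  ... | no ¬cv | _      = no λ (cv , _) → ¬cv (λ u v → cv u v)
  ... | yes _  | no ¬ex = no λ (_ , ex , _) → ¬ex (λ u v → ex u v)
  ... | yes cv | yes ex = map′ (λ p → (λ u v → cv u v) , (λ u v → ex u v) , p)
                               (λ (_ , _ , p) → resp (λ _ _ → refl) p)
                               (P? (orientation o (λ u v → cv u v) (λ u v → ex u v)))

Forceable : Graph n → ℕ → ℕ → Set
Forceable G k s = Σ (Orientation G) λ D → ∃[ S ] IsForcingSet k D S × count S ≡ s

Forceable? : ∀ (G : Graph n) k s → Dec (Forceable G k s)
Forceable? G k s = any-orientation? {G = G} {P = λ D → ∃[ S ] IsForcingSet k D S × count S ≡ s}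
  (λ {D} {D′} out≡ (S , forcing , |S|≡s) → S , IsForcingSet-cong D D′ out≡ (λ _ → refl) forcing , |S|≡s)
  λ D → any-predicate? {P = λ S → IsForcingSet k D S × count S ≡ s}
    (λ S≗S′ (forcing , |S|≡s) → IsForcingSet-cong D D (λ _ _ → refl) S≗S′ forcing ,
                                 trans (sym (count-cong S≗S′)) |S|≡s)
    (λ S → IsForcingSet? k D S ×-dec (count S ℕ.≟ s))

forest⇒Forceable : ∀ {G : Graph (suc n)} {k root} → RootedForest G k root → Forceable G k (count root)
forest⇒Forceable F = forestOrientation F , _ , forest-forcing F zero , refl

cover⇒Forceable : ∀ {G : Graph (suc n)} {k c} → 1 ≤ k → TreeCover G k c → Forceable G k c
cover⇒Forceable {G = G} {k} 1≤k TC =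
  subst (Forceable G k) (count-leafRoot 1≤k TC) (forest⇒Forceable (cover-forest 1≤k TC))

Forceable⇒cover : ∀ {G : Graph n} {k s} → Forceable G k s → TreeCover G k s
Forceable⇒cover {G = G} {k} (D , S , forcing , |S|≡s) =
  subst (TreeCover G k) |S|≡s (forest-cover (forcing-forest D forcing))

discrete-forest : ∀ (G : Graph n) k → RootedForest G k (λ _ → true)
discrete-forest {n} G k = record
  { parent      = λ v → v
  ; rank        = λ _ → 0
  ; parent-adj  = λ _ ()
  ; parent-rank = λ _ ()
  ; children-≤  = λ _ → ≤-trans (≤-reflexive (count-false {n})) z≤n
  }

least-Forceable⇒IsMof : ∀ {G : Graph n} {k m} → IsMinOf (Forceable G k) m → IsMof G k m
least-Forceable⇒IsMof ((D , S , forcing , |S|≡m) , minimal) =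
  (D , (S , forcing , |S|≡m) , λ x (S′ , forcing′ , |S′|≡x) → minimal x (D , S′ , forcing′ , |S′|≡x))
  , λ x (D′ , (S′ , forcing′ , |S′|≡x) , _) → minimal x (D′ , S′ , forcing′ , |S′|≡x)

least-Forceable⇒IsTk : ∀ {G : Graph (suc n)} {k m} → 1 ≤ k → IsMinOf (Forceable G k) m → IsTk G k m
least-Forceable⇒IsTk 1≤k (forceable , minimal) =
  Forceable⇒cover forceable , λ c TC → minimal c (cover⇒Forceable 1≤k TC)

theorem3p4 : ∀ {n} (G : Graph (suc n)) (k : ℕ) → 1 ≤ k →
    ∃[ m ] (IsMof G k m × IsTk G k m)
theorem3p4 G k 1≤k with m , least ← least-witness (Forceable? G k) (forest⇒Forceable (discrete-forest G k))
  = m , least-Forceable⇒IsMof least , least-Forceable⇒IsTk 1≤k least
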